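{- Let $S=\langle s,h\rangle$ be a state and $t$ a spanning tree of $S$. If all edges of $S$ are local with respect to $t$, then for every spanning tree $t'$ of $S$ we have $t \sim_{t'^{ -1}\circ t} t'$, and moreover all edges of $S$ are local with respect to $t'$.
   Context: A state is a pair $\langle s,h\rangle$ with $s$ a partial map from variables to locations and $h: Loc\rightharpoonup_{fin}(Sel\rightharpoonup_{fin} Loc)$ a finite partial function (with $Sel$ a finite set of selectors, and each $\ell\in dom(h)$ having at least one defined selector). An edge is a triple $\ell\xrightarrow{k}\ell'$ with $h(\ell)(k)=\ell'$. Trees: a tree over an alphabet $\Sigma$ is a finite partial function $t:\mathbb{N}^*\rightharpoonup\Sigma$ whose domain is prefix-closed and such that $p.i\in dom(t)$ implies $p.j\in dom(t)$ for all $0\le j<i$. Its direction alphabet is $\mathcal{D}(t)=\{ -1,0,\dots,N\}$ where $N$ is the maximal $i$ with some $p.i\in dom(t)$, and $\mathcal{D}_+(t)=\mathcal{D}(t)\setminus\{ -1\}$; by convention $(p.i).(-1)=p$. For trees $t_1,t_2$ and a bijection $r:dom(t_1)\to dom(t_2)$, we write $t_1\sim_r t_2$ iff for all $p\in dom(t_1)$ and $d\in\mathcal{D}_+(t_1)$ with $p.d\in dom(t_1)$ there is $e\in\mathcal{D}(t_2)$ with $r(p.d)=r(p).e$. A spanning tree of $S$ is a tree $t$ that is a bijection from $dom(t)$ onto $dom(h)$ such that for all $p\in dom(t)$ and $d\in\mathcal{D}_+(t)$ with $p.d\in dom(t)$ there is $k\in Sel$ with $t(p)\xrightarrow{k}t(p.d)$.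 An edge $\ell\xrightarrow{k}\ell'$ is local with respect to a spanning tree $t$ iff there exist $p\in dom(t)$ and $d\in\mathcal{D}(t)\cup\{\epsilon\}$ with $t(p)=\ell$ and $t(p.d)=\ell'$. -}

module Defs where

open import Data.Nat using (ℕ; _≤_; _<_)
open import Data.Fin using (Fin)
open import Data.List using (List; []; _∷_)
open import Data.List.Membership.Propositional using (_∈_)
open import Data.Maybe using (Maybe; just; nothing)
open import Data.Product using (Σ; ∃; ∃-syntax; _×_; _,_)
open import Data.Sum using (_⊎_)
open import Data.Unit using (⊤)
open import Function.Bundles using (_⇔_)
open import Relation.Binary.PropositionalEquality using (_≡_)

Loc : Set
Loc = ℕ

Var : Set
Var = ℕ

Sel : ℕ → Set
Sel nSel = Fin nSel

Def : {A B : Set} → (A → Maybe B) → A → Set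
Def f x = ∃[ b ] (f x ≡ just b)

FinDom : {A B : Set} → (A → Maybe B) → Set
FinDom {A} f = ∃[ L ] (∀ (x : A) → Def f x → x ∈ L)

Heap : ℕ → Set
Heap nSel = Loc → Maybe (Sel nSel → Maybe Loc)

record State (nSel : ℕ) : Set where
  constructor ⟨_,_⟩
  field
    s : Var → Maybe Loc
    h : Heap nSel
open State public

WellFormed : ∀ {nSel} → State nSel → Set
WellFormed S = FinDom (h S)
  × (∀ ℓ f → h S ℓ ≡ just f → ∃[ k ] Def f k)

Edge : ∀ {nSel} → State nSel → Loc → Sel nSel → Loc → Set
Edge S ℓ k ℓ' = ∃[ f ] (h S ℓ ≡ just f × f k ≡ just ℓ')

-- Trees. A position p ∈ ℕ* is stored REVERSED as a list:
-- the position p.i is represented by  i ∷ p  (root ε is []).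

Pos : Set
Pos = List ℕ

LTree : Set
LTree = Pos → Maybe Loc

IsTree : LTree → Set
IsTree t =
    (∀ i p → Def t (i ∷ p) → Def t p)
  × (∀ i j p → j < i → Def t (i ∷ p) → Def t (j ∷ p))
  × FinDom t

-- directions: up = -1, down i = i
data Dir : Set where
  up   : Dir
  down : ℕ → Dir

step : Pos → Dir → Maybe Pos
step []      up       = nothing
step (i ∷ p) up       = just p
step p       (down i) = just (i ∷ p)

-- d ∈ 𝒟₊(t): i ≤ N where N is the maximal child index occurring in t
InDplus : LTree → ℕ → Set
InDplus t i = ∃[ j ] ∃[ p ] (i ≤ j × Def t (j ∷ p))

InD : LTree → Dir → Set
InD t up       = ⊤
InD t (down i) = InDplus t i

At : LTree → Pos → Dir → Loc → Set
At t p d ℓ = ∃[ q ] (step p d ≡ just q × t q ≡ just ℓ)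

Spanning : ∀ {nSel} → State nSel → LTree → Set
Spanning S t =
    IsTree t
  × (∀ p q ℓ → t p ≡ just ℓ → t q ≡ just ℓ → p ≡ q)
  × (∀ ℓ → (∃[ p ] (t p ≡ just ℓ)) ⇔ Def (h S) ℓ)
  × (∀ p i ℓ ℓ' → InDplus t i → t p ≡ just ℓ → t (i ∷ p) ≡ just ℓ'
       → ∃[ k ] Edge S ℓ k ℓ')

Local : LTree → Loc → Loc → Set
Local t ℓ ℓ' = ∃[ p ] (t p ≡ just ℓ ×
    (t p ≡ just ℓ' ⊎ ∃[ d ] (InD t d × At t p d ℓ')))

AllLocal : ∀ {nSel} → State nSel → LTree → Set
AllLocal S t = ∀ ℓ k ℓ' → Edge S ℓ k ℓ' → Local t ℓ ℓ'

-- the relation r = t₂⁻¹ ∘ t₁ on positions: r(p) = q iff t₁(p) = t₂(q)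
InvComp : LTree → LTree → Pos → Pos → Set
InvComp t₂ t₁ p q = ∃[ ℓ ] (t₁ p ≡ just ℓ × t₂ q ≡ just ℓ)

-- t₁ ∼_r t₂, r given as a (functional) relation on positions:
-- for p ∈ dom t₁, d ∈ 𝒟₊(t₁) with p.d ∈ dom t₁, ∃ e ∈ 𝒟(t₂) with r(p.d) = r(p).e
Sim : LTree → LTree → (Pos → Pos → Set) → Set
Sim t₁ t₂ r = ∀ p i q q' → Def t₁ p → InDplus t₁ i → Def t₁ (i ∷ p)
  → r p q → r (i ∷ p) q' → ∃[ e ] (InD t₂ e × step q e ≡ just q')

-- A t'-edge joins two locations whose t-positions are equal or adjacent, and equality
-- is excluded by injectivity. Given a t-edge from p to its child i.p, follow the t'-path
-- from the t'-position of t(p) or of t(i.p) up to the root of t': exactly one end of the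
-- path lies in the t-subtree below i.p, so some t'-edge crosses into that subtree. Being
-- t-adjacent, it can only join the locations t(p) and t(i.p), and since t' is injective
-- the t'-positions of t(p) and t(i.p) are adjacent in t'. Locality of the edges of S then
-- transfers from t to t' along with adjacency.
module Submission where

open import Defs
open import Data.Nat using (ℕ; _≟_)
open import Data.Nat.Properties using (≤-refl; 1+n≰n)
open import Data.List using ([]; _∷_)
open import Data.List.Relation.Binary.Pointwise using (Pointwise-≡⇒≡; ≡⇒Pointwise-≡)
open import Data.List.Relation.Binary.Suffix.Heterogeneous using (Suffix; here; there)
open import Data.List.Relation.Binary.Suffix.Heterogeneous.Properties
  using (length-mono; suffix?)
open import Data.Maybe using (just)
open import Data.Product using (∃-syntax; _×_; _,_; proj₂)
open import Data.Sum using (_⊎_; inj₁; inj₂)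
open import Function.Bundles using (_⇔_; Equivalence)
import Function.Properties.Equivalence as ⇔
open import Relation.Nullary using (¬_; Dec; yes; no; contradiction)
open import Relation.Nullary.Decidable using (¬?; decidable-stable)
open import Relation.Unary using (Decidable)
open import Relation.Binary.PropositionalEquality using (_≡_; _≢_; refl; sym; trans; subst)

-- Positions are stored reversed, so the subtree rooted at s consists of the positions
-- having s as a suffix.
_≼_ : Pos → Pos → Set
_≼_ = Suffix _≡_

infix 4 _≼_ _≼?_

_≼?_ : ∀ s q → Dec (s ≼ q)
_≼?_ = suffix? _≟_

≼-refl : ∀ {s} → s ≼ s
≼-refl = here (≡⇒Pointwise-≡ refl)

child⋠parent : ∀ i p → ¬ i ∷ p ≼ p
child⋠parent i p ip≼p = 1+n≰n (length-mono ip≼p)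

child≢parent : ∀ i p → p ≢ i ∷ p
child≢parent i p p≡ip = child⋠parent i p (here (≡⇒Pointwise-≡ (sym p≡ip)))

subtree-entry : ∀ {s k o} → s ≼ k ∷ o → ¬ s ≼ o → s ≡ k ∷ o
subtree-entry (here s≡ko) _   = Pointwise-≡⇒≡ s≡ko
subtree-entry (there s≼o) s⋠o = contradiction s≼o s⋠o

Adjacent : Pos → Pos → Set
Adjacent p q = ∃[ j ] (q ≡ j ∷ p) ⊎ ∃[ j ] (p ≡ j ∷ q)

adjacent-sym : ∀ {p q} → Adjacent p q → Adjacent q p
adjacent-sym (inj₁ q-child) = inj₂ q-child
adjacent-sym (inj₂ p-child) = inj₁ p-child

adjacent-entry : ∀ {k o a b} → Adjacent a b → ¬ k ∷ o ≼ a → k ∷ o ≼ b → a ≡ o × b ≡ k ∷ o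
adjacent-entry (inj₁ (j , refl)) s⋠a s≼b with subtree-entry s≼b s⋠a
... | refl = refl , refl
adjacent-entry (inj₂ (j , refl)) s⋠a s≼b = contradiction (there s≼b) s⋠a

step-down : ∀ p i → step p (down i) ≡ just (i ∷ p)
step-down []      i = refl
step-down (_ ∷ _) i = refl

step⇒adjacent : ∀ {p} d {q} → step p d ≡ just q → Adjacent p q
step⇒adjacent {[]}    up       ()
step⇒adjacent {j ∷ p} up       refl = inj₂ (j , refl)
step⇒adjacent {[]}    (down i) refl = inj₁ (i , refl)
step⇒adjacent {_ ∷ _} (down i) refl = inj₁ (i , refl)

adjacent⇒step : ∀ t {q q'} → Def t q' → Adjacent q q' → ∃[ e ] (InD t e × step q e ≡ just q')
adjacent⇒step t {q} q'∈t (inj₁ (j , refl)) = down j , (j , q , ≤-refl , q'∈t) , step-down q j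
adjacent⇒step t     _    (inj₂ (j , refl)) = up , _ , refl

Injective : LTree → Set
Injective t = ∀ p q ℓ → t p ≡ just ℓ → t q ≡ just ℓ → p ≡ q

Image : LTree → Loc → Set
Image t ℓ = ∃[ p ] (t p ≡ just ℓ)

Near : Pos → Pos → Set
Near p q = p ≡ q ⊎ Adjacent p q

local⇒near : ∀ {t ℓ ℓ'} → Local t ℓ ℓ' →
  ∃[ p ] ∃[ p' ] (t p ≡ just ℓ × t p' ≡ just ℓ' × Near p p')
local⇒near (p , tp , inj₁ tp') = p , p , tp , tp' , inj₁ refl
local⇒near (p , tp , inj₂ (d , _ , p' , st , tp')) = p , p' , tp , tp' , inj₂ (step⇒adjacent d st)

near⇒local : ∀ {t q q' ℓ ℓ'} → t q ≡ just ℓ → t q' ≡ just ℓ' → Near q q' → Local t ℓ ℓ'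
near⇒local tq tq' (inj₁ refl) = _ , tq , inj₁ tq'
near⇒local {t} tq tq' (inj₂ adj) with adjacent⇒step t (_ , tq') adj
... | e , e∈D , st = _ , tq , inj₂ (e , e∈D , _ , st , tq')

module Relabelling (t t' : LTree)
  (t-injective : Injective t) (t'-injective : Injective t')
  (same-image : ∀ ℓ → Image t ℓ ⇔ Image t' ℓ)
  (t'-prefix-closed : ∀ i q → Def t' (i ∷ q) → Def t' q)
  (t'-edges-local : ∀ q j ℓ ℓ' → t' q ≡ just ℓ → t' (j ∷ q) ≡ just ℓ' → Local t ℓ ℓ')
  where

  _≈_ : Pos → Pos → Set
  _≈_ = InvComp t' t

  t-position : ∀ {q ℓ} → t' q ≡ just ℓ → ∃[ p ] (p ≈ q)
  t-position {q} {ℓ} t'q with Equivalence.from (same-image ℓ) (q , t'q)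
  ... | p , tp = p , ℓ , tp , t'q

  ≈-functional : ∀ {p q q'} → p ≈ q → p ≈ q' → q ≡ q'
  ≈-functional (ℓ , tp , t'q) (_ , tp' , t'q') with trans (sym tp) tp'
  ... | refl = t'-injective _ _ ℓ t'q t'q'

  ≈-injective : ∀ {p p' q} → p ≈ q → p' ≈ q → p ≡ p'
  ≈-injective (ℓ , tp , t'q) (_ , tp' , t'q') with trans (sym t'q) t'q'
  ... | refl = t-injective _ _ ℓ tp tp'

  root-defined : ∀ q → Def t' q → Def t' []
  root-defined []      q∈t' = q∈t'
  root-defined (i ∷ q) q∈t' = root-defined q (t'-prefix-closed i q q∈t')

  path-leaves : ∀ {P : Pos → Set} → Decidable P → ∀ {q pq pr} →
    pq ≈ q → pr ≈ [] → P pq → ¬ P pr →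
    ∃[ q₀ ] ∃[ j ] ∃[ a ] ∃[ b ] (a ≈ q₀ × b ≈ (j ∷ q₀) × ¬ P a × P b)
  path-leaves {P} P? {[]} pq≈ pr≈ Ppq ¬Ppr =
    contradiction (subst P (≈-injective pq≈ pr≈) Ppq) ¬Ppr
  path-leaves P? {j ∷ q} {pq} pq≈ pr≈ Ppq ¬Ppr
    with t'-prefix-closed j q (_ , proj₂ (proj₂ pq≈))
  ... | _ , t'q with t-position t'q
  ...   | a , a≈q with P? a
  ...     | yes Pa  = path-leaves P? a≈q pr≈ Pa ¬Ppr
  ...     | no  ¬Pa = q , j , a , pq , a≈q , pq≈ , ¬Pa , Ppq

  edge-adjacent : ∀ {a b q j} → a ≈ q → b ≈ (j ∷ q) → Adjacent a b
  edge-adjacent {a} {b} {q} {j} a≈q@(ℓ , ta , t'q) b≈jq@(ℓ' , tb , t'jq)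
    with local⇒near (t'-edges-local q j ℓ ℓ' t'q t'jq)
  ... | p , p' , tp , tp' , near
    with t-injective p a ℓ tp ta | t-injective p' b ℓ' tp' tb | near
  ... | refl | refl | inj₂ adj  = adj
  ... | refl | refl | inj₁ refl = contradiction (≈-functional a≈q b≈jq) (child≢parent j q)

  entering-edge : ∀ {i p q q' q₀ j a b} → p ≈ q → (i ∷ p) ≈ q' → a ≈ q₀ → b ≈ (j ∷ q₀) →
    ¬ i ∷ p ≼ a → i ∷ p ≼ b → q' ≡ j ∷ q
  entering-edge p≈q ip≈q' a≈ b≈ a∉ b∈ with adjacent-entry (edge-adjacent a≈ b≈) a∉ b∈
  ... | refl , refl with ≈-functional p≈q a≈ | ≈-functional ip≈q' b≈
  ...   | refl | refl = refl

  leaving-edge : ∀ {i p q q' q₀ j a b} → p ≈ q → (i ∷ p) ≈ q' → a ≈ q₀ → b ≈ (j ∷ q₀) →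
    i ∷ p ≼ a → ¬ i ∷ p ≼ b → q ≡ j ∷ q'
  leaving-edge p≈q ip≈q' a≈ b≈ a∈ b∉ with adjacent-entry (adjacent-sym (edge-adjacent a≈ b≈)) b∉ a∈
  ... | refl , refl with ≈-functional p≈q b≈ | ≈-functional ip≈q' a≈
  ...   | refl | refl = refl

  child-adjacent : ∀ {i p q q'} → p ≈ q → (i ∷ p) ≈ q' → Adjacent q q'
  child-adjacent {i} {p} {q} p≈q ip≈q' with t-position (proj₂ (root-defined q (_ , proj₂ (proj₂ p≈q))))
  ... | r , r≈root with (i ∷ p) ≼? r
  ... | no r∉ with path-leaves ((i ∷ p) ≼?_) ip≈q' r≈root ≼-refl r∉
  ...   | _ , j , _ , _ , a≈ , b≈ , a∉ , b∈ = inj₁ (j , entering-edge p≈q ip≈q' a≈ b≈ a∉ b∈)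
  child-adjacent {i} {p} p≈q ip≈q' | r , r≈root | yes r∈
    with path-leaves (λ x → ¬? ((i ∷ p) ≼? x)) p≈q r≈root (child⋠parent i p) (λ r∉ → r∉ r∈)
  ... | _ , j , a , _ , a≈ , b≈ , ¬a∉ , b∉ =
    inj₂ (j , leaving-edge p≈q ip≈q' a≈ b≈ (decidable-stable ((i ∷ p) ≼? a) ¬a∉) b∉)

  adjacent-preserved : ∀ {p p' q q'} → Adjacent p p' → p ≈ q → p' ≈ q' → Adjacent q q'
  adjacent-preserved (inj₁ (_ , refl)) p≈q p'≈q' = child-adjacent p≈q p'≈q'
  adjacent-preserved (inj₂ (_ , refl)) p≈q p'≈q' = adjacent-sym (child-adjacent p'≈q' p≈q)

  near-preserved : ∀ {p p' q q'} → Near p p' → p ≈ q → p' ≈ q' → Near q q'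
  near-preserved (inj₁ refl) p≈q p≈q' = inj₁ (≈-functional p≈q p≈q')
  near-preserved (inj₂ adj)  p≈q p'≈q' = inj₂ (adjacent-preserved adj p≈q p'≈q')

  sim : Sim t t' _≈_
  sim _ _ _ _ _ _ _ p≈q ip≈q'@(ℓ , _ , t'q') =
    adjacent⇒step t' (ℓ , t'q') (child-adjacent p≈q ip≈q')

  local-preserved : ∀ {ℓ ℓ'} → Local t ℓ ℓ' → Local t' ℓ ℓ'
  local-preserved local with local⇒near local
  ... | p , p' , tp , tp' , near
    with Equivalence.to (same-image _) (p , tp) | Equivalence.to (same-image _) (p' , tp')
  ... | q , t'q | q' , t'q' =
    near⇒local t'q t'q' (near-preserved near (_ , tp , t'q) (_ , tp' , t'q'))

lemma1 : ∀ {nSel : ℕ} (S : State nSel) → WellFormed S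
    → (t : LTree) → Spanning S t → AllLocal S t
    → (t' : LTree) → Spanning S t'
    → Sim t t' (InvComp t' t) × AllLocal S t'
lemma1 _ _ t (_ , t-injective , t-onto , _) all-local
       t' ((t'-prefix-closed , _) , t'-injective , t'-onto , t'-edges) =
  sim , λ ℓ k ℓ' edge → local-preserved (all-local ℓ k ℓ' edge)
  where
  same-image : ∀ ℓ → Image t ℓ ⇔ Image t' ℓ
  same-image ℓ = ⇔.trans (t-onto ℓ) (⇔.sym (t'-onto ℓ))

  t'-edges-local : ∀ q j ℓ ℓ' → t' q ≡ just ℓ → t' (j ∷ q) ≡ just ℓ' → Local t ℓ ℓ'
  t'-edges-local q j ℓ ℓ' t'q t'jq with t'-edges q j ℓ ℓ' (j , q , ≤-refl , ℓ' , t'jq) t'q t'jq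
  ... | k , edge = all-local ℓ k ℓ' edge

  open Relabelling t t' t-injective t'-injective same-image t'-prefix-closed t'-edges-local
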